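{- Let $\alpha \in (0,1)$. Then $d_{PLR}$ is a semi-metric on the set of reconciled gene trees under $\simeq_d$; that is: (i) $d_{PLR}(\mathcal{G}, \mathcal{G}) = 0$ for every reconciled gene tree $\mathcal{G}$; (ii) $d_{PLR}(\mathcal{G}_1, \mathcal{G}_2) = d_{PLR}(\mathcal{G}_2, \mathcal{G}_1)$ for all reconciled gene trees $\mathcal{G}_1, \mathcal{G}_2$; (iii) if $\mathcal{G}_1 \not\simeq_d \mathcal{G}_2$, then $d_{PLR}(\mathcal{G}_1, \mathcal{G}_2) > 0$.
   Context: All trees are rooted; $L(T)$ is the leaf set, $L(T(v))$ the leaves descending from $v$, $\mathrm{lca}_T$ lowest common ancestor, $dist_T$ path length in edges. A species tree $S$ is a rooted binary tree. A reconciled gene tree is a tuple $\mathcal{G} = (G, S, \mu, l)$ where $G$ is a rooted tree in which every internal node has at least two children, $\mu : V(G) \to V(S)$, $l : V(G) \to \{dup, spec, extant\}$, such that: (1) leaves map to leaves of $S$ and have label $extant$, internal nodes have label $dup$ or $spec$; (2) $u \preceq_G v$ implies $\mu(u) \preceq_S \mu(v)$; (3) if $l(v) = spec$ then $\mu(v)$ is internal in $S$, $v$ has exactly two children $v_1,v_2$, and with $s_1,s_2$ the children of $\mu(v)$, either $\mu(v_1) \preceq_S s_1, \mu(v_2) \preceq_S s_2$ or $\mu(v_2) \preceq_S s_1, \mu(v_1) \preceq_S s_2$. $\mathcal{G}_1,\mathcal{G}_2$ are comparable if they use the same $S$, $L(G_1)=L(G_2)$ and $\mu_1(x)=\mu_2(x)$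 for every leaf $x$. For $v \in V(G_1)$, $m(v) = \mathrm{lca}_{G_2}(L(G_1(v)))$; $d_{path}(\mathcal{G}_1,\mathcal{G}_2) = \sum_{v \in V(G_1)} dist_S(\mu_1(v), \mu_2(m(v)))$; $d_{lbl}(\mathcal{G}_1,\mathcal{G}_2) = |\{v \in V(G_1): l_1(v) \neq l_2(m(v))\}|$; $d_{asym} = \alpha d_{path} + (1-\alpha) d_{lbl}$; $d_{PLR}(\mathcal{G}_1,\mathcal{G}_2) = d_{asym}(\mathcal{G}_1,\mathcal{G}_2) + d_{asym}(\mathcal{G}_2,\mathcal{G}_1)$ if comparable, and $\infty$ otherwise. Two reconciled gene trees $\mathcal{G}_1, \mathcal{G}_2$ with the same species tree are isomorphic, $\mathcal{G}_1 \simeq \mathcal{G}_2$, if $L(G_1) = L(G_2)$ and there is a bijection $\phi: V(G_1) \to V(G_2)$ with $\phi(x) = x$ for every leaf $x$, $uv \in E(G_1) \iff \phi(u)\phi(v) \in E(G_2)$, and $\mu_1(v) = \mu_2(\phi(v))$, $l_1(v) = l_2(\phi(v))$ for all $v$. An edge $uv$ with $u$ the parent of $v$ is redundant if $\mu(u)=\mu(v)$ and $l(u)=l(v)=dup$. Contracting a redundant edge $uv$: delete $v$ and its incident edges, add an edge from $u$ to each child of $v$, restrict $\mu, l$. $LR(\mathcal{G})$ is obtained by contracting all redundant edges of $\mathcal{G}$. $\mathcal{G}_1 \simeq_d \mathcal{G}_2$ means $LR(\mathcal{G}_1) \simeq LR(\mathcal{G}_2)$.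
   Formalization: The parameter α ranges over the rationals in (0,1), so $d_{PLR}$ takes values in the rationals extended by ∞. -}

module Defs where

open import Data.Nat using (ℕ; zero; suc; _+_; _∸_; _≤_) renaming (_*_ to _*ℕ_; _≟_ to _≟ℕ_)
open import Data.Integer using (+_)
open import Data.Rational using (ℚ; 0ℚ; 1ℚ; _<_) renaming (_/_ to _/ℚ_; _+_ to _+ℚ_; _*_ to _*ℚ_; _-_ to _-ℚ_)
open import Data.List using (List; []; _∷_; _++_; [_]; length; _∷ʳ_)
open import Data.List.Properties using (≡-dec)
open import Data.List.Relation.Unary.All using (All; all?)
open import Data.List.Relation.Unary.Unique.Propositional using (Unique)
open import Data.List.Relation.Binary.Pointwise using (Pointwise)
open import Data.List.Relation.Binary.Permutation.Propositional using (_↭_)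
open import Data.List.Membership.Propositional using (_∈_)
open import Data.List.Membership.DecPropositional _≟ℕ_ using (_∈?_)
open import Data.Product using (Σ; ∃; ∃₂; _×_; _,_; proj₁; proj₂)
open import Data.Product.Properties using () renaming (≡-dec to ×-≡-dec)
open import Data.Sum using (_⊎_)
open import Data.Maybe using (Maybe; just; nothing)
open import Data.Bool using (Bool; true; false; if_then_else_; _∧_)
open import Data.Unit using (⊤)
open import Relation.Nullary using (Dec; yes; no; ¬_; does)
open import Relation.Nullary.Decidable using (_×-dec_; _→-dec_)
open import Relation.Binary.PropositionalEquality using (_≡_; _≢_; refl)

-- Species trees: rooted binary trees.  A vertex of S is named by its
-- root-to-vertex path (list of left/right steps).

data STree : Set where
  sleaf : STree
  snode : STree → STree → STree

data Dir : Set where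
  left right : Dir

Path : Set
Path = List Dir

subtreeAt : STree → Path → Maybe STree
subtreeAt t             []            = just t
subtreeAt sleaf         (_ ∷ _)       = nothing
subtreeAt (snode l r)   (left  ∷ p)   = subtreeAt l p
subtreeAt (snode l r)   (right ∷ p)   = subtreeAt r p

IsVertex : STree → Path → Set
IsVertex S p = ∃ λ t → subtreeAt S p ≡ just t

IsLeafOf : STree → Path → Set
IsLeafOf S p = subtreeAt S p ≡ just sleaf

IsInternalOf : STree → Path → Set
IsInternalOf S p = ∃₂ λ l r → subtreeAt S p ≡ just (snode l r)

-- u ⪯_S v  (u is a descendant of v, or equal): path of v is a prefix of path of u
_⪯S_ : Path → Path → Set
u ⪯S v = ∃ λ r → v ++ r ≡ u

-- depth of lca of two vertices = length of common prefix
cpl : Path → Path → ℕ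
cpl (left  ∷ p) (left  ∷ q) = suc (cpl p q)
cpl (right ∷ p) (right ∷ q) = suc (cpl p q)
cpl _ _ = 0

distS : Path → Path → ℕ
distS p q = (length p + length q) ∸ (2 *ℕ cpl p q)

_≟Dir_ : (a b : Dir) → Dec (a ≡ b)
left  ≟Dir left  = yes refl
right ≟Dir right = yes refl
left  ≟Dir right = no λ ()
right ≟Dir left  = no λ ()

_≟Path_ : (p q : Path) → Dec (p ≡ q)
_≟Path_ = ≡-dec _≟Dir_

_≟S_ : (s t : STree) → Dec (s ≡ t)
sleaf ≟S sleaf = yes refl
sleaf ≟S snode _ _ = no λ ()
snode _ _ ≟S sleaf = no λ ()
snode l r ≟S snode l' r' with l ≟S l' | r ≟S r'
... | yes refl | yes refl = yes refl
... | no ne | _ = no λ { refl → ne refl }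
... | yes _ | no ne = no λ { refl → ne refl }

-- Every vertex
-- carries its image under μ (a vertex of S, as a path) and internal
-- vertices carry their event label; leaves have label extant.

Gene : Set
Gene = ℕ

data Event : Set where
  dup spec extant : Event

_≟E_ : (a b : Event) → Dec (a ≡ b)
dup ≟E dup = yes refl
spec ≟E spec = yes refl
extant ≟E extant = yes refl
dup ≟E spec = no λ ()
dup ≟E extant = no λ ()
spec ≟E dup = no λ ()
spec ≟E extant = no λ ()
extant ≟E dup = no λ ()
extant ≟E spec = no λ ()

data GTree : Set where
  leaf : Gene → Path → GTree
  node : Path → Event → List GTree → GTree

μ : GTree → Path
μ (leaf _ p) = p
μ (node p _ _) = p

lbl : GTree → Event
lbl (leaf _ _) = extant
lbl (node _ e _) = e

mutual
  leaves : GTree → List Gene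
  leaves (leaf x _) = [ x ]
  leaves (node _ _ cs) = leavesL cs

  leavesL : List GTree → List Gene
  leavesL [] = []
  leavesL (c ∷ cs) = leaves c ++ leavesL cs

mutual
  leafMap : GTree → List (Gene × Path)
  leafMap (leaf x p) = [ (x , p) ]
  leafMap (node _ _ cs) = leafMapL cs

  leafMapL : List GTree → List (Gene × Path)
  leafMapL [] = []
  leafMapL (c ∷ cs) = leafMap c ++ leafMapL cs

SpecOK : STree → Path → List GTree → Set
SpecOK S p cs = IsInternalOf S p × ∃₂ λ c₁ c₂ → (cs ≡ c₁ ∷ c₂ ∷ [])
  × ((μ c₁ ⪯S (p ∷ʳ left) × μ c₂ ⪯S (p ∷ʳ right))
     ⊎ (μ c₂ ⪯S (p ∷ʳ left) × μ c₁ ⪯S (p ∷ʳ right)))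

-- Condition (2) is imposed on every parent/child edge (which by
-- transitivity of ⪯ gives it for all ancestor/descendant pairs).
data WF (S : STree) : GTree → Set where
  wf-leaf : ∀ {x p} → IsLeafOf S p → WF S (leaf x p)
  wf-node : ∀ {p e cs} →
            IsVertex S p →
            e ≢ extant →
            2 ≤ length cs →
            All (λ c → μ c ⪯S p) cs →
            (e ≡ spec → SpecOK S p cs) →
            All (WF S) cs →
            WF S (node p e cs)

record RGT : Set where
  constructor rgt
  field
    S  : STree
    G  : GTree
    wf : WF S G
    leaves-distinct : Unique (leaves G)
open RGT public

_⊆?_ : (xs ys : List Gene) → Bool
xs ⊆? ys = does (all? (_∈? ys) xs)

mutual
  lcaT : GTree → List Gene → GTree
  lcaT (leaf x p) xs = leaf x p
  lcaT (node p e cs) xs = lcaL cs xs (node p e cs)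

  lcaL : List GTree → List Gene → GTree → GTree
  lcaL [] xs d = d
  lcaL (c ∷ cs) xs d = if xs ⊆? leaves c then lcaT c xs else lcaL cs xs d

mutual
  sumV : (GTree → ℕ) → GTree → ℕ
  sumV f (leaf x p) = f (leaf x p)
  sumV f (node p e cs) = f (node p e cs) + sumVL f cs

  sumVL : (GTree → ℕ) → List GTree → ℕ
  sumVL f [] = 0
  sumVL f (c ∷ cs) = sumV f c + sumVL f cs

mmap : GTree → GTree → GTree
mmap G₂ v = lcaT G₂ (leaves v)

dpath : GTree → GTree → ℕ
dpath G₁ G₂ = sumV (λ v → distS (μ v) (μ (mmap G₂ v))) G₁

dlbl : GTree → GTree → ℕ
dlbl G₁ G₂ = sumV (λ v → if does (lbl v ≟E lbl (mmap G₂ v)) then 0 else 1) G₁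

toℚ : ℕ → ℚ
toℚ n = (+ n) /ℚ 1

dasym : ℚ → GTree → GTree → ℚ
dasym α G₁ G₂ = (α *ℚ toℚ (dpath G₁ G₂)) +ℚ ((1ℚ -ℚ α) *ℚ toℚ (dlbl G₁ G₂))

Comparable : RGT → RGT → Set
Comparable 𝒢₁ 𝒢₂ =
  (S 𝒢₁ ≡ S 𝒢₂) ×
  All (_∈ leaves (G 𝒢₂)) (leaves (G 𝒢₁)) ×
  All (_∈ leaves (G 𝒢₁)) (leaves (G 𝒢₂)) ×
  All (λ xp → All (λ yq → proj₁ xp ≡ proj₁ yq → proj₂ xp ≡ proj₂ yq)
                  (leafMap (G 𝒢₂)))
      (leafMap (G 𝒢₁))

comparable? : (𝒢₁ 𝒢₂ : RGT) → Dec (Comparable 𝒢₁ 𝒢₂)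
comparable? 𝒢₁ 𝒢₂ =
  (S 𝒢₁ ≟S S 𝒢₂) ×-dec
  (all? (_∈? leaves (G 𝒢₂)) (leaves (G 𝒢₁)) ×-dec
  (all? (_∈? leaves (G 𝒢₁)) (leaves (G 𝒢₂)) ×-dec
  all? (λ xp → all? (λ yq → (proj₁ xp ≟ℕ proj₁ yq) →-dec (proj₂ xp ≟Path proj₂ yq))
                    (leafMap (G 𝒢₂)))
       (leafMap (G 𝒢₁))))

data ℚ∞ : Set where
  fin : ℚ → ℚ∞
  ∞   : ℚ∞

Positive∞ : ℚ∞ → Set
Positive∞ (fin q) = 0ℚ < q
Positive∞ ∞ = ⊤

dPLR : ℚ → RGT → RGT → ℚ∞
dPLR α 𝒢₁ 𝒢₂ with comparable? 𝒢₁ 𝒢₂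
... | yes _ = fin (dasym α (G 𝒢₁) (G 𝒢₂) +ℚ dasym α (G 𝒢₂) (G 𝒢₁))
... | no  _ = ∞

-- Isomorphism: a leaf-preserving bijection of vertices preserving edges,
-- μ and l.  For these ordered representations of unordered trees this is:
-- equal roots (μ, l; leaves equal as genes) and children matched up to a
-- permutation by isomorphisms.

data _≅T_ : GTree → GTree → Set where
  leaf≅ : ∀ {x p} → leaf x p ≅T leaf x p
  node≅ : ∀ {p e cs ds} (es : List GTree) →
          cs ↭ es → Pointwise _≅T_ es ds →
          node p e cs ≅T node p e ds

_≃_ : RGT → RGT → Set
𝒢₁ ≃ 𝒢₂ = (S 𝒢₁ ≡ S 𝒢₂) × (G 𝒢₁ ≅T G 𝒢₂)

redundant : Path → Event → GTree → Bool
redundant p e (leaf _ _) = false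
redundant p e (node q f _) = does (e ≟E dup) ∧ does (f ≟E dup) ∧ does (p ≟Path q)

splice : Path → Event → GTree → List GTree
splice p e (leaf x q) = [ leaf x q ]
splice p e (node q f ds) = if redundant p e (node q f ds) then ds else [ node q f ds ]

mutual
  LR : GTree → GTree
  LR (leaf x p) = leaf x p
  LR (node p e cs) = node p e (LRL p e cs)

  LRL : Path → Event → List GTree → List GTree
  LRL p e [] = []
  LRL p e (c ∷ cs) = splice p e (LR c) ++ LRL p e cs

_≃d_ : RGT → RGT → Set
𝒢₁ ≃d 𝒢₂ = (S 𝒢₁ ≡ S 𝒢₂) × (LR (G 𝒢₁) ≅T LR (G 𝒢₂))

-- Parts (i) and (ii) are immediate: in a tree with distinct leaves m(v) = lca(L(v)) is v itself,
-- and d_PLR adds the two asymmetric terms. For (iii), α and 1 − α are positive, so d_PLR = 0 means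
-- that, in both directions, every vertex v has the species and event of m(v). Then any u ⊑ G₁ and
-- u′ ⊑ G₂ with the same leaf set have isomorphic contractions, by well-founded induction on u: the
-- children of LR(u) are the contractions of the frontier of u (its first non-redundant descendants),
-- and m is a leaf-set preserving bijection between the frontiers of u and u′. The crux is that m
-- cannot send a frontier vertex x to a larger cluster, for then m(m(x)) would lie strictly between x
-- and u with the species and event of x, making x redundant.
module Submission where

open import Defs
open import Data.Bool using (true; false; if_then_else_)
open import Data.Bool.Properties using (¬-not)
open import Data.Empty using (⊥-elim)
open import Data.List using (List; []; _∷_; _++_; [_]; map; length; _∷ʳ_)
open import Data.List.Properties using (++-assoc; ++-identityʳ; ++-identityʳ-unique; map-∘; map-id-local; map-++)
open import Data.List.Membership.Propositional using (_∈_)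
open import Data.List.Membership.Propositional.Properties using (∈-++⁺ˡ; ∈-++⁺ʳ; ∈-++⁻; ∈-map⁺; ∈-map⁻)
open import Data.List.Membership.Propositional.Properties.WithK using (unique∧set⇒bag)
open import Data.List.Relation.Binary.BagAndSetEquality using (∼bag⇒↭)
open import Data.List.Relation.Binary.Disjoint.Propositional using (Disjoint)
open import Data.List.Relation.Binary.Permutation.Propositional using (_↭_)
import Data.List.Relation.Binary.Permutation.Propositional.Properties as ↭
open import Data.List.Relation.Binary.Pointwise using (Pointwise; []; _∷_)
open import Data.List.Relation.Binary.Subset.Propositional using (_⊆_)
open import Data.List.Relation.Unary.All as All using (All; []; _∷_; all?)
import Data.List.Relation.Unary.All.Properties as All
open import Data.List.Relation.Unary.Any using (here; there)
open import Data.List.Relation.Unary.AllPairs using ([]; _∷_)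
open import Data.List.Relation.Unary.Unique.Propositional using (Unique)
import Data.List.Relation.Unary.Unique.Propositional.Properties as Unique
open import Data.Nat using (ℕ; zero; suc; _+_; _*_; _∸_; _≤_; s≤s; _≟_) renaming (_<_ to _<ℕ_)
open import Data.List.Membership.DecPropositional _≟_ using (_∈?_)
open import Data.Nat.Induction using (<-wellFounded)
open import Data.Nat.Properties using (+-suc; m+n≡0⇒m≡0; m+n≡0⇒n≡0; ≤-refl; ≤-trans; m≤m+n; m≤n+m; m≤n⇒m≤1+n; <⇒≱)
open import Data.Rational using (ℚ; 0ℚ; 1ℚ; _<_; -_; Positive; NonNegative; positive)
  renaming (_+_ to _+ℚ_; _*_ to _*ℚ_; _-_ to _-ℚ_)
open import Data.Rational.Properties
  using (normalize-nonNeg; normalize-pos; pos⇒nonNeg; nonNeg*nonNeg⇒nonNeg; pos*pos⇒pos; nonNeg+nonNeg⇒nonNeg;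
         pos+nonNeg⇒pos; nonNeg+pos⇒pos; positive⁻¹; +-inverseʳ; +-monoˡ-<; *-zeroʳ; +-identityʳ; +-comm)
open import Data.Product using (∃-syntax; _×_; _,_; proj₁; proj₂)
open import Data.Sum using (_⊎_; inj₁; inj₂)
open import Data.Unit using (tt)
open import Function using (_∘_)
open import Function.Bundles using (mk⇔)
open import Induction.WellFounded using (WellFounded; Acc; acc; module Subrelation)
import Relation.Binary.Construct.On as On
open import Relation.Nullary using (¬_; Dec; yes; no; does; contradiction)
open import Relation.Nullary.Decidable using (dec-true; does-⇔)
open import Relation.Binary.PropositionalEquality using (_≡_; _≢_; refl; sym; trans; cong; cong₂; subst; module ≡-Reasoning)

module _ {A : Set} where

  Unique-++⁻ˡ : ∀ (xs : List A) {ys} → Unique (xs ++ ys) → Unique xs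
  Unique-++⁻ˡ []       _          = []
  Unique-++⁻ˡ (x ∷ xs) (x∉ ∷ xs!) = All.++⁻ˡ xs x∉ ∷ Unique-++⁻ˡ xs xs!

  Unique-++⁻ʳ : ∀ (xs : List A) {ys} → Unique (xs ++ ys) → Unique ys
  Unique-++⁻ʳ []       ys!       = ys!
  Unique-++⁻ʳ (x ∷ xs) (_ ∷ xs!) = Unique-++⁻ʳ xs xs!

  Unique-++⁻-disjoint : ∀ (xs : List A) {ys} → Unique (xs ++ ys) → Disjoint xs ys
  Unique-++⁻-disjoint (x ∷ xs) (x∉ ∷ _)   (here refl , v∈ys) = All.lookup x∉ (∈-++⁺ʳ xs v∈ys) refl
  Unique-++⁻-disjoint (x ∷ xs) (_ ∷ xs!)  (there v∈xs , v∈ys) = Unique-++⁻-disjoint xs xs! (v∈xs , v∈ys)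

  unique∧set⇒↭ : ∀ {xs ys : List A} → Unique xs → Unique ys → xs ⊆ ys → ys ⊆ xs → xs ↭ ys
  unique∧set⇒↭ xs! ys! xs⊆ys ys⊆xs = ∼bag⇒↭ (unique∧set⇒bag xs! ys! (mk⇔ xs⊆ys ys⊆xs))

  Unique-map⁺-leftInverse : ∀ {B : Set} {f : A → B} {g : B → A} {xs} →
                            All (λ x → g (f x) ≡ x) xs → Unique xs → Unique (map f xs)
  Unique-map⁺-leftInverse {f = f} {g} {xs} g∘f≡id xs! =
    Unique.map⁻ {f = g} (subst Unique (sym (trans (sym (map-∘ xs)) (map-id-local g∘f≡id))) xs!)

-- Subtrees and leaf sets

data _⊑_ (t : GTree) : GTree → Set where
  ⊑-refl  : t ⊑ t
  ⊑-child : ∀ {p e cs c} → c ∈ cs → t ⊑ c → t ⊑ node p e cs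

_⊑L_ : GTree → List GTree → Set
t ⊑L cs = ∃[ c ] c ∈ cs × t ⊑ c

data _⊏_ (t : GTree) : GTree → Set where
  ⊏-node : ∀ {p e cs} → t ⊑L cs → t ⊏ node p e cs

⊑-trans : ∀ {a b c} → a ⊑ b → b ⊑ c → a ⊑ c
⊑-trans a⊑b ⊑-refl            = a⊑b
⊑-trans a⊑b (⊑-child c∈ b⊑c) = ⊑-child c∈ (⊑-trans a⊑b b⊑c)

⊏⇒⊑ : ∀ {a T} → a ⊏ T → a ⊑ T
⊏⇒⊑ (⊏-node (_ , c∈ , a⊑c)) = ⊑-child c∈ a⊑c

⊑⇒≡⊎⊏ : ∀ {a T} → a ⊑ T → a ≡ T ⊎ a ⊏ T
⊑⇒≡⊎⊏ ⊑-refl            = inj₁ refl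
⊑⇒≡⊎⊏ (⊑-child c∈ a⊑c) = inj₂ (⊏-node (_ , c∈ , a⊑c))

mutual
  size : GTree → ℕ
  size (leaf _ _)    = 1
  size (node _ _ cs) = suc (sizeL cs)

  sizeL : List GTree → ℕ
  sizeL []       = 0
  sizeL (c ∷ cs) = size c + sizeL cs

∈⇒size≤ : ∀ {c cs} → c ∈ cs → size c ≤ sizeL cs
∈⇒size≤ {cs = c ∷ cs} (here refl) = m≤m+n (size c) (sizeL cs)
∈⇒size≤ {cs = c ∷ cs} (there c∈) = ≤-trans (∈⇒size≤ c∈) (m≤n+m (sizeL cs) (size c))

⊑⇒size≤ : ∀ {t T} → t ⊑ T → size t ≤ size T
⊑⇒size≤ ⊑-refl            = ≤-refl
⊑⇒size≤ (⊑-child c∈ t⊑c) = m≤n⇒m≤1+n (≤-trans (⊑⇒size≤ t⊑c) (∈⇒size≤ c∈))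

⊏⇒size< : ∀ {t T} → t ⊏ T → size t <ℕ size T
⊏⇒size< (⊏-node (_ , c∈ , t⊑c)) = s≤s (≤-trans (⊑⇒size≤ t⊑c) (∈⇒size≤ c∈))

⊏⇒⋣ : ∀ {a b} → a ⊏ b → ¬ (b ⊑ a)
⊏⇒⋣ a⊏b b⊑a = <⇒≱ (⊏⇒size< a⊏b) (⊑⇒size≤ b⊑a)

⊏-wellFounded : WellFounded _⊏_
⊏-wellFounded = Subrelation.wellFounded ⊏⇒size< (On.wellFounded size <-wellFounded)

WF-⊑ : ∀ {S t T} → t ⊑ T → WF S T → WF S t
WF-⊑ ⊑-refl            wfT                       = wfT
WF-⊑ (⊑-child c∈ t⊑c) (wf-node _ _ _ _ _ wf-cs) = WF-⊑ t⊑c (All.lookup wf-cs c∈)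

WF-children : ∀ {S p e cs} → WF S (node p e cs) → All (WF S) cs
WF-children (wf-node _ _ _ _ _ wf-cs) = wf-cs

leaves-∈ : ∀ {c cs} → c ∈ cs → leaves c ⊆ leavesL cs
leaves-∈ {cs = c ∷ cs} (here refl) = ∈-++⁺ˡ
leaves-∈ {cs = c ∷ cs} (there c∈) = ∈-++⁺ʳ (leaves c) ∘ leaves-∈ c∈

leaves-⊑ : ∀ {t T} → t ⊑ T → leaves t ⊆ leaves T
leaves-⊑ ⊑-refl            = λ x∈ → x∈
leaves-⊑ (⊑-child c∈ t⊑c) = leaves-∈ c∈ ∘ leaves-⊑ t⊑c

leaves-⊑L : ∀ {t cs} → t ⊑L cs → leaves t ⊆ leavesL cs
leaves-⊑L (_ , c∈ , t⊑c) = leaves-∈ c∈ ∘ leaves-⊑ t⊑c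

leaves-⊏ : ∀ {t T} → t ⊏ T → leaves t ⊆ leaves T
leaves-⊏ (⊏-node t⊑cs) = leaves-⊑L t⊑cs

Unique-leaves-∈ : ∀ {c cs} → c ∈ cs → Unique (leavesL cs) → Unique (leaves c)
Unique-leaves-∈ {cs = c ∷ cs} (here refl) cs! = Unique-++⁻ˡ (leaves c) cs!
Unique-leaves-∈ {cs = c ∷ cs} (there c∈) cs! = Unique-leaves-∈ c∈ (Unique-++⁻ʳ (leaves c) cs!)

Unique-leaves-⊑ : ∀ {t T} → t ⊑ T → Unique (leaves T) → Unique (leaves t)
Unique-leaves-⊑ ⊑-refl            T! = T!
Unique-leaves-⊑ (⊑-child c∈ t⊑c) T! = Unique-leaves-⊑ t⊑c (Unique-leaves-∈ c∈ T!)

leaves-nonempty : ∀ {S T} → WF S T → ∃[ x ] x ∈ leaves T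
leaves-nonempty (wf-leaf _) = _ , here refl
leaves-nonempty {T = node _ _ []}      (wf-node _ _ () _ _ _)
leaves-nonempty {T = node _ _ (c ∷ _)} (wf-node _ _ _ _ _ (wf-c ∷ _)) =
  let x , x∈ = leaves-nonempty wf-c in x , ∈-++⁺ˡ x∈

-- Every vertex has at least two children, and they have disjoint leaf sets.
⊏⇒leaves⊈ : ∀ {S t T} → WF S T → Unique (leaves T) → t ⊏ T → ¬ (leaves T ⊆ leaves t)
⊏⇒leaves⊈ {T = node _ _ []}          (wf-node _ _ () _ _ _)
⊏⇒leaves⊈ {T = node _ _ (_ ∷ [])}    (wf-node _ _ (s≤s ()) _ _ _)
⊏⇒leaves⊈ {T = node _ _ (c₁ ∷ c₂ ∷ _)} (wf-node _ _ _ _ _ (wf₁ ∷ wf₂ ∷ _)) T! (⊏-node (c , c∈ , t⊑c)) T⊆t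
  with leaves-nonempty wf₁ | leaves-nonempty wf₂ | c∈
... | a , a∈c₁ | _ | there c∈′ =
  Unique-++⁻-disjoint (leaves c₁) T! (a∈c₁ , leaves-∈ c∈′ (leaves-⊑ t⊑c (T⊆t (∈-++⁺ˡ a∈c₁))))
... | _ | b , b∈c₂ | here refl =
  Unique-++⁻-disjoint (leaves c₁) T! (leaves-⊑ t⊑c (T⊆t (∈-++⁺ʳ (leaves c₁) (∈-++⁺ˡ b∈c₂))) , ∈-++⁺ˡ b∈c₂)

-- Lowest common ancestors

⊆?-sound : ∀ {xs ys} → xs ⊆? ys ≡ true → xs ⊆ ys
⊆?-sound {xs} {ys} xs⊆?ys with all? (_∈? ys) xs
⊆?-sound _  | yes all-∈ = All.lookup all-∈
⊆?-sound () | no _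

⊆?-complete : ∀ {xs ys} → xs ⊆ ys → xs ⊆? ys ≡ true
⊆?-complete {xs} {ys} xs⊆ys = dec-true (all? (_∈? ys) xs) (All.tabulate xs⊆ys)

⊆?-cong : ∀ {xs xs′} ys → xs ⊆ xs′ → xs′ ⊆ xs → xs ⊆? ys ≡ xs′ ⊆? ys
⊆?-cong {xs} {xs′} ys xs⊆xs′ xs′⊆xs =
  does-⇔ (mk⇔ (restrict xs′⊆xs) (restrict xs⊆xs′)) (all? (_∈? ys) xs) (all? (_∈? ys) xs′)
  where restrict : ∀ {as bs} → bs ⊆ as → All (_∈ ys) as → All (_∈ ys) bs
        restrict bs⊆as all-as = All.tabulate (All.lookup all-as ∘ bs⊆as)

mutual
  lca-⊑ : ∀ T xs → lcaT T xs ⊑ T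
  lca-⊑ (leaf _ _)    _  = ⊑-refl
  lca-⊑ (node _ _ cs) xs = lcaL-⊑ cs xs (λ c∈ → c∈)

  lcaL-⊑ : ∀ {p e ds} cs xs → cs ⊆ ds → lcaL cs xs (node p e ds) ⊑ node p e ds
  lcaL-⊑ []       xs _     = ⊑-refl
  lcaL-⊑ (c ∷ cs) xs cs⊆ds with xs ⊆? leaves c
  ... | true  = ⊑-child (cs⊆ds (here refl)) (lca-⊑ c xs)
  ... | false = lcaL-⊑ cs xs (cs⊆ds ∘ there)

mutual
  lca-covers : ∀ T {xs} → xs ⊆ leaves T → xs ⊆ leaves (lcaT T xs)
  lca-covers (leaf _ _)    xs⊆T = xs⊆T
  lca-covers (node _ _ cs) xs⊆T = lcaL-covers cs xs⊆T

  lcaL-covers : ∀ cs {xs d} → xs ⊆ leaves d → xs ⊆ leaves (lcaL cs xs d)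
  lcaL-covers []       xs⊆d = xs⊆d
  lcaL-covers (c ∷ cs) {xs} xs⊆d with xs ⊆? leaves c in xs⊆?c
  ... | true  = lca-covers c (⊆?-sound xs⊆?c)
  ... | false = lcaL-covers cs xs⊆d

lcaL-child : ∀ {cs c xs a} d → Unique (leavesL cs) → c ∈ cs → xs ⊆ leaves c → a ∈ xs →
             lcaL cs xs d ≡ lcaT c xs
lcaL-child {c ∷ _} {xs = xs} _ _ (here refl) xs⊆c _ rewrite ⊆?-complete xs⊆c = refl
lcaL-child {c′ ∷ cs} {xs = xs} d cs! (there c∈) xs⊆c a∈xs with xs ⊆? leaves c′ in xs⊆?c′
... | true  = contradiction (⊆?-sound xs⊆?c′ a∈xs , leaves-∈ c∈ (xs⊆c a∈xs)) (Unique-++⁻-disjoint (leaves c′) cs!)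
... | false = lcaL-child d (Unique-++⁻ʳ (leaves c′) cs!) c∈ xs⊆c a∈xs

lca-least : ∀ {T y xs a} → Unique (leaves T) → y ⊑ T → xs ⊆ leaves y → a ∈ xs → lcaT T xs ⊑ y
lca-least {T} {xs = xs} _ ⊑-refl _ _ = lca-⊑ T xs
lca-least {node p e cs} T! (⊑-child c∈ y⊑c) xs⊆y a∈xs
  rewrite lcaL-child (node p e cs) T! c∈ (leaves-⊑ y⊑c ∘ xs⊆y) a∈xs =
  lca-least (Unique-leaves-∈ c∈ T!) y⊑c xs⊆y a∈xs

mmap-self : ∀ {S T y} → WF S T → Unique (leaves T) → y ⊑ T → mmap T y ≡ y
mmap-self {T = T} {y} wfT T! y⊑T with leaves-nonempty (WF-⊑ y⊑T wfT)
... | a , a∈y with ⊑⇒≡⊎⊏ (lca-least T! y⊑T (λ x∈ → x∈) a∈y)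
...   | inj₁ m≡y = m≡y
...   | inj₂ m⊏y = ⊥-elim (⊏⇒leaves⊈ (WF-⊑ y⊑T wfT) (Unique-leaves-⊑ y⊑T T!) m⊏y
                              (lca-covers T (leaves-⊑ y⊑T)))

mutual
  lca-cong : ∀ T {xs ys} → xs ⊆ ys → ys ⊆ xs → lcaT T xs ≡ lcaT T ys
  lca-cong (leaf _ _)    _     _     = refl
  lca-cong (node _ _ cs) xs⊆ys ys⊆xs = lcaL-cong cs xs⊆ys ys⊆xs

  lcaL-cong : ∀ cs {xs ys d} → xs ⊆ ys → ys ⊆ xs → lcaL cs xs d ≡ lcaL cs ys d
  lcaL-cong []       _     _     = refl
  lcaL-cong (c ∷ cs) {ys = ys} xs⊆ys ys⊆xs rewrite ⊆?-cong (leaves c) xs⊆ys ys⊆xs with ys ⊆? leaves c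
  ... | true  = lca-cong c xs⊆ys ys⊆xs
  ... | false = lcaL-cong cs xs⊆ys ys⊆xs

leaves-⊆⇒⊑ : ∀ {S T y z} → WF S T → Unique (leaves T) → y ⊑ T → z ⊑ T → leaves y ⊆ leaves z → y ⊑ z
leaves-⊆⇒⊑ wfT T! y⊑T z⊑T y⊆z with leaves-nonempty (WF-⊑ y⊑T wfT)
... | a , a∈y = subst (_⊑ _) (mmap-self wfT T! y⊑T) (lca-least T! z⊑T y⊆z a∈y)

-- Species images and redundant edges

⪯S-refl : ∀ p → p ⪯S p
⪯S-refl p = [] , ++-identityʳ p

⪯S-trans : ∀ {a b c} → a ⪯S b → b ⪯S c → a ⪯S c
⪯S-trans {c = c} (r , b++r≡a) (r′ , c++r′≡b) =
  r′ ++ r , trans (sym (++-assoc c r′ r)) (trans (cong (_++ r) c++r′≡b) b++r≡a)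

⋠∷ʳ : ∀ p d → ¬ (p ⪯S (p ∷ʳ d))
⋠∷ʳ p d (r , p∷ʳd++r≡p) with ++-identityʳ-unique p (sym (trans (sym (++-assoc p [ d ] r)) p∷ʳd++r≡p))
... | ()

μ-mono : ∀ {S y T} → WF S T → y ⊑ T → μ y ⪯S μ T
μ-mono {T = T} _ ⊑-refl = ⪯S-refl (μ T)
μ-mono (wf-node _ _ _ cs⪯ _ wf-cs) (⊑-child c∈ y⊑c) =
  ⪯S-trans (μ-mono (All.lookup wf-cs c∈) y⊑c) (All.lookup cs⪯ c∈)

SpecOK-child : ∀ {S p cs c} → SpecOK S p cs → c ∈ cs → ∃[ d ] μ c ⪯S (p ∷ʳ d)
SpecOK-child (_ , _ , _ , refl , inj₁ (c₁⪯ , _)) (here refl)         = left , c₁⪯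
SpecOK-child (_ , _ , _ , refl , inj₁ (_ , c₂⪯)) (there (here refl)) = right , c₂⪯
SpecOK-child (_ , _ , _ , refl , inj₂ (_ , c₁⪯)) (here refl)         = right , c₁⪯
SpecOK-child (_ , _ , _ , refl , inj₂ (c₂⪯ , _)) (there (here refl)) = left , c₂⪯

⊏-same-species⇒dup : ∀ {S y T} → WF S T → y ⊏ T → μ y ≡ μ T → lbl T ≡ dup
⊏-same-species⇒dup {T = node p dup _}    _ _ _ = refl
⊏-same-species⇒dup {T = node p extant _} (wf-node _ e≢extant _ _ _ _) _ _ = contradiction refl e≢extant
⊏-same-species⇒dup {T = node p spec _}   (wf-node _ _ _ _ spec-ok wf-cs) (⊏-node (c , c∈ , y⊑c)) μy≡p
  with SpecOK-child (spec-ok refl) c∈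
... | d , c⪯ = contradiction (subst (_⪯S (p ∷ʳ d)) μy≡p (⪯S-trans (μ-mono (All.lookup wf-cs c∈) y⊑c) c⪯)) (⋠∷ʳ p d)

record Redundant (p : Path) (e : Event) (t : GTree) : Set where
  constructor mkRedundant
  field
    parent-dup   : e ≡ dup
    child-dup    : lbl t ≡ dup
    same-species : μ t ≡ p

Redundant-resp : ∀ {p e a b} → Redundant p e a → μ b ≡ μ a → lbl b ≡ lbl a → Redundant p e b
Redundant-resp (mkRedundant e≡dup la≡dup μa≡p) μb≡μa lb≡la = mkRedundant e≡dup (trans lb≡la la≡dup) (trans μb≡μa μa≡p)

Redundant⇒redundant : ∀ {p e} t → Redundant p e t → redundant p e t ≡ true
Redundant⇒redundant (node p dup _) (mkRedundant refl refl refl) = dec-true (p ≟Path p) refl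

redundant⇒Redundant : ∀ {p e} t → redundant p e t ≡ true → Redundant p e t
redundant⇒Redundant {p} {e} (node q f _) _ with e ≟E dup | f ≟E dup | p ≟Path q
redundant⇒Redundant (node _ _ _) _  | yes refl | yes refl | yes refl = mkRedundant refl refl refl
redundant⇒Redundant (node _ _ _) () | no _     | _        | _
redundant⇒Redundant (node _ _ _) () | yes _    | no _     | _
redundant⇒Redundant (node _ _ _) () | yes _    | yes _    | no _

¬Redundant⇒redundant≡false : ∀ {p e} t → ¬ Redundant p e t → redundant p e t ≡ false
¬Redundant⇒redundant≡false t ¬red = ¬-not (¬red ∘ redundant⇒Redundant t)

descendant-Redundant : ∀ {S p e cs y} → WF S (node p e cs) → y ⊏ node p e cs →
                       μ y ≡ p → lbl y ≡ e → Redundant p e y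
descendant-Redundant {e = e} wf y⊏ μy≡p ly≡e = mkRedundant e≡dup (trans ly≡e e≡dup) μy≡p
  where
  e≡dup : e ≡ dup
  e≡dup = ⊏-same-species⇒dup wf y⊏ μy≡p

-- Frontiers: frontier p e t lists the vertices of t that become children of a vertex with species
-- p and event e once the redundant edges above them are contracted.

mutual
  frontier : Path → Event → GTree → List GTree
  frontier p e (leaf x q)    = [ leaf x q ]
  frontier p e (node q f ds) = if redundant p e (node q f ds) then frontierL p e ds else [ node q f ds ]

  frontierL : Path → Event → List GTree → List GTree
  frontierL p e []       = []
  frontierL p e (c ∷ cs) = frontier p e c ++ frontierL p e cs

mutual
  splice-LR : ∀ p e c → splice p e (LR c) ≡ map LR (frontier p e c)
  splice-LR p e (leaf _ _) = refl
  splice-LR p e (node q f ds) with e ≟E dup | f ≟E dup | p ≟Path q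
  ... | yes refl | yes refl | yes refl = LRL-frontierL p dup ds
  ... | no _     | _        | _        = refl
  ... | yes _    | no _     | _        = refl
  ... | yes _    | yes _    | no _     = refl

  LRL-frontierL : ∀ p e cs → LRL p e cs ≡ map LR (frontierL p e cs)
  LRL-frontierL p e []       = refl
  LRL-frontierL p e (c ∷ cs) =
    trans (cong₂ _++_ (splice-LR p e c) (LRL-frontierL p e cs)) (sym (map-++ LR (frontier p e c) (frontierL p e cs)))

leavesL-++ : ∀ cs ds → leavesL (cs ++ ds) ≡ leavesL cs ++ leavesL ds
leavesL-++ []       ds = refl
leavesL-++ (c ∷ cs) ds = trans (cong (leaves c ++_) (leavesL-++ cs ds)) (sym (++-assoc (leaves c) _ _))

mutual
  leaves-frontier : ∀ p e c → leavesL (frontier p e c) ≡ leaves c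
  leaves-frontier p e (leaf _ _) = refl
  leaves-frontier p e (node q f ds) with redundant p e (node q f ds)
  ... | true  = leaves-frontierL p e ds
  ... | false = ++-identityʳ _

  leaves-frontierL : ∀ p e cs → leavesL (frontierL p e cs) ≡ leavesL cs
  leaves-frontierL p e []       = refl
  leaves-frontierL p e (c ∷ cs) =
    trans (leavesL-++ (frontier p e c) (frontierL p e cs))
          (cong₂ _++_ (leaves-frontier p e c) (leaves-frontierL p e cs))

RedundantBetween : Path → Event → GTree → (GTree → Set) → Set
RedundantBetween p e x Below = ∀ {y} → x ⊏ y → Below y → Redundant p e y

mutual
  frontier-sound : ∀ {S p e c x} → WF S c → Unique (leaves c) → x ∈ frontier p e c →
                   x ⊑ c × ¬ Redundant p e x × RedundantBetween p e x (_⊑ c)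
  frontier-sound {c = leaf _ _} _ _ (here refl) =
    ⊑-refl , (λ ()) ∘ Redundant.child-dup , λ x⊏y y⊑x → ⊥-elim (⊏⇒⋣ x⊏y y⊑x)
  frontier-sound {p = p} {e} {node q f ds} wf c! x∈ with redundant p e (node q f ds) in red
  frontier-sound {c = c@(node _ _ _)} _ _ (here refl) | false =
    ⊑-refl , (λ red′ → contradiction (trans (sym (Redundant⇒redundant c red′)) red) λ ()) ,
    λ x⊏y y⊑x → ⊥-elim (⊏⇒⋣ x⊏y y⊑x)
  frontier-sound {c = c@(node _ _ _)} wf c! x∈ | true with frontierL-sound (WF-children wf) c! x∈
  ... | (d , d∈ , x⊑d) , ¬red , between = ⊑-child d∈ x⊑d , ¬red , between′
    where
    between′ : RedundantBetween _ _ _ (_⊑ _)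
    between′ x⊏y y⊑c with ⊑⇒≡⊎⊏ y⊑c
    ... | inj₁ refl = redundant⇒Redundant c red
    ... | inj₂ (⊏-node y⊑ds) = between x⊏y y⊑ds

  frontierL-sound : ∀ {S p e cs x} → All (WF S) cs → Unique (leavesL cs) → x ∈ frontierL p e cs →
                    x ⊑L cs × ¬ Redundant p e x × RedundantBetween p e x (_⊑L cs)
  frontierL-sound {p = p} {e} {c ∷ cs} (wf-c ∷ wf-cs) cs! x∈ with ∈-++⁻ (frontier p e c) x∈
  ... | inj₁ x∈c with frontier-sound wf-c (Unique-++⁻ˡ (leaves c) cs!) x∈c
  ...   | x⊑c , ¬red , between = (c , here refl , x⊑c) , ¬red , between′
    where
    between′ : RedundantBetween _ _ _ (_⊑L (c ∷ cs))
    between′ x⊏y (_ , here refl , y⊑c)  = between x⊏y y⊑c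
    between′ x⊏y (_ , there d∈ , y⊑d) with leaves-nonempty (WF-⊑ x⊑c wf-c)
    ... | a , a∈x = contradiction (leaves-⊑ x⊑c a∈x , leaves-∈ d∈ (leaves-⊑ y⊑d (leaves-⊏ x⊏y a∈x)))
                                  (Unique-++⁻-disjoint (leaves c) cs!)
  frontierL-sound {p = p} {e} {c ∷ cs} (wf-c ∷ wf-cs) cs! x∈ | inj₂ x∈cs
    with frontierL-sound wf-cs (Unique-++⁻ʳ (leaves c) cs!) x∈cs
  ... | (d , d∈ , x⊑d) , ¬red , between = (d , there d∈ , x⊑d) , ¬red , between′
    where
    between′ : RedundantBetween _ _ _ (_⊑L (c ∷ cs))
    between′ x⊏y (_ , there d′∈ , y⊑d′) = between x⊏y (_ , d′∈ , y⊑d′)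
    between′ x⊏y (_ , here refl , y⊑c) with leaves-nonempty (WF-⊑ x⊑d (All.lookup wf-cs d∈))
    ... | a , a∈x = contradiction (leaves-⊑ y⊑c (leaves-⊏ x⊏y a∈x) , leaves-∈ d∈ (leaves-⊑ x⊑d a∈x))
                                  (Unique-++⁻-disjoint (leaves c) cs!)

mutual
  frontier-complete : ∀ {p e c x} → x ⊑ c → ¬ Redundant p e x → RedundantBetween p e x (_⊑ c) →
                      x ∈ frontier p e c
  frontier-complete {c = leaf _ _} ⊑-refl _ _ = here refl
  frontier-complete {c = c@(node _ _ _)} ⊑-refl ¬red _ rewrite ¬Redundant⇒redundant≡false c ¬red = here refl
  frontier-complete {c = c@(node _ _ _)} (⊑-child d∈ x⊑d) ¬red between
    rewrite Redundant⇒redundant c (between (⊏-node (_ , d∈ , x⊑d)) ⊑-refl) =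
    frontierL-complete (_ , d∈ , x⊑d) ¬red (λ x⊏y (_ , d′∈ , y⊑d′) → between x⊏y (⊑-child d′∈ y⊑d′))

  frontierL-complete : ∀ {p e cs x} → x ⊑L cs → ¬ Redundant p e x → RedundantBetween p e x (_⊑L cs) →
                       x ∈ frontierL p e cs
  frontierL-complete {cs = c ∷ _} (_ , here refl , x⊑c) ¬red between =
    ∈-++⁺ˡ (frontier-complete x⊑c ¬red (λ x⊏y y⊑c → between x⊏y (c , here refl , y⊑c)))
  frontierL-complete {p} {e} {c ∷ _} (d , there d∈ , x⊑d) ¬red between =
    ∈-++⁺ʳ (frontier p e c) (frontierL-complete (d , d∈ , x⊑d) ¬red
      (λ x⊏y (d′ , d′∈ , y⊑d′) → between x⊏y (d′ , there d′∈ , y⊑d′)))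

frontierL-⊏ : ∀ {S p e cs x} → WF S (node p e cs) → Unique (leavesL cs) → x ∈ frontierL p e cs → x ⊏ node p e cs
frontierL-⊏ wf cs! x∈ = ⊏-node (proj₁ (frontierL-sound (WF-children wf) cs! x∈))

leavesL-Unique⇒Unique : ∀ {S ts} → All (WF S) ts → Unique (leavesL ts) → Unique ts
leavesL-Unique⇒Unique []              _   = []
leavesL-Unique⇒Unique {ts = t ∷ ts} (wf-t ∷ wf-ts) ts! =
  All.tabulate t≢ ∷ leavesL-Unique⇒Unique wf-ts (Unique-++⁻ʳ (leaves t) ts!)
  where
  t≢ : ∀ {t′} → t′ ∈ ts → t ≢ t′
  t≢ t′∈ t≡t′ with leaves-nonempty wf-t
  ... | a , a∈t = Unique-++⁻-disjoint (leaves t) ts! (a∈t , leaves-∈ t′∈ (subst (λ s → a ∈ leaves s) t≡t′ a∈t))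

frontierL-Unique : ∀ {S p e cs} → WF S (node p e cs) → Unique (leavesL cs) → Unique (frontierL p e cs)
frontierL-Unique {p = p} {e} {cs} wf cs! =
  leavesL-Unique⇒Unique (All.tabulate (λ x∈ → WF-⊑ (⊏⇒⊑ (frontierL-⊏ wf cs! x∈)) wf))
                        (subst Unique (sym (leaves-frontierL p e cs)) cs!)

Redundant-lookalike : ∀ {S p e cs ds x y z} → WF S (node p e ds) → RedundantBetween p e x (_⊑L cs) →
                      x ⊏ z → z ⊑ node p e cs → y ⊏ node p e ds → μ y ≡ μ z → lbl y ≡ lbl z → Redundant p e y
Redundant-lookalike wf between x⊏z z⊑u y⊏u′ μy≡μz ly≡lz with ⊑⇒≡⊎⊏ z⊑u
... | inj₁ refl          = descendant-Redundant wf y⊏u′ μy≡μz ly≡lz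
... | inj₂ (⊏-node z⊑cs) = Redundant-resp (between x⊏z z⊑cs) μy≡μz ly≡lz

-- Trees at distance zero

Agrees : GTree → GTree → Set
Agrees G₁ G₂ = ∀ {v} → v ⊑ G₁ → μ v ≡ μ (mmap G₂ v) × lbl v ≡ lbl (mmap G₂ v)

module Matching (𝒢₁ 𝒢₂ : RGT) (agrees₁₂ : Agrees (G 𝒢₁) (G 𝒢₂)) (agrees₂₁ : Agrees (G 𝒢₂) (G 𝒢₁)) where

  open RGT 𝒢₁ using () renaming (S to S₁; G to T₁; wf to wf₁; leaves-distinct to T₁!)
  open RGT 𝒢₂ using () renaming (S to S₂; G to T₂; wf to wf₂; leaves-distinct to T₂!)

  same-leaves⇒agree : ∀ {u u′} → u ⊑ T₁ → u′ ⊑ T₂ → leaves u ⊆ leaves u′ → leaves u′ ⊆ leaves u →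
                      μ u ≡ μ u′ × lbl u ≡ lbl u′
  same-leaves⇒agree {u} {u′} u⊑ u′⊑ u⊆u′ u′⊆u =
    trans (proj₁ (agrees₁₂ u⊑)) (cong μ mmap-u≡u′) , trans (proj₂ (agrees₁₂ u⊑)) (cong lbl mmap-u≡u′)
    where
    mmap-u≡u′ : mmap T₂ u ≡ u′
    mmap-u≡u′ = trans (lca-cong T₂ u⊆u′ u′⊆u) (mmap-self wf₂ T₂! u′⊑)

  module _ {p e cs ds x} (u⊑ : node p e cs ⊑ T₁) (u′⊑ : node p e ds ⊑ T₂)
           (cs⊆ds : leavesL cs ⊆ leavesL ds) (ds⊆cs : leavesL ds ⊆ leavesL cs)
           (x∈ : x ∈ frontierL p e cs) where

    private
      wf-u : WF S₁ (node p e cs)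
      wf-u = WF-⊑ u⊑ wf₁

      wf-u′ : WF S₂ (node p e ds)
      wf-u′ = WF-⊑ u′⊑ wf₂

      u! : Unique (leavesL cs)
      u! = Unique-leaves-⊑ u⊑ T₁!

      x-sound : x ⊑L cs × ¬ Redundant p e x × RedundantBetween p e x (_⊑L cs)
      x-sound = frontierL-sound (WF-children wf-u) u! x∈

      ¬red-x : ¬ Redundant p e x
      ¬red-x = proj₁ (proj₂ x-sound)

      between-x : RedundantBetween p e x (_⊑L cs)
      between-x = proj₂ (proj₂ x-sound)

      x⊏u : x ⊏ node p e cs
      x⊏u = ⊏-node (proj₁ x-sound)

      x⊑T₁ : x ⊑ T₁
      x⊑T₁ = ⊑-trans (⊏⇒⊑ x⊏u) u⊑

      x-leaf : ∃[ a ] a ∈ leaves x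
      x-leaf = leaves-nonempty (WF-⊑ x⊑T₁ wf₁)

      w : GTree
      w = mmap T₂ x

      z : GTree
      z = mmap T₁ w

      w⊑T₂ : w ⊑ T₂
      w⊑T₂ = lca-⊑ T₂ (leaves x)

      w⊑u′ : w ⊑ node p e ds
      w⊑u′ = lca-least T₂! u′⊑ (cs⊆ds ∘ leaves-⊏ x⊏u) (proj₂ x-leaf)

      x⊆w : leaves x ⊆ leaves w
      x⊆w = lca-covers T₂ (leaves-⊑ u′⊑ ∘ cs⊆ds ∘ leaves-⊏ x⊏u)

      w⊆z : leaves w ⊆ leaves z
      w⊆z = lca-covers T₁ (leaves-⊑ u⊑ ∘ ds⊆cs ∘ leaves-⊑ w⊑u′)

      z⊑u : z ⊑ node p e cs
      z⊑u = lca-least T₁! u⊑ (ds⊆cs ∘ leaves-⊑ w⊑u′) (x⊆w (proj₂ x-leaf))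

      x⊑z : x ⊑ z
      x⊑z = leaves-⊆⇒⊑ wf₁ T₁! x⊑T₁ (lca-⊑ T₁ (leaves w)) (w⊆z ∘ x⊆w)

      μx≡μw : μ x ≡ μ w
      μx≡μw = proj₁ (agrees₁₂ x⊑T₁)

      lx≡lw : lbl x ≡ lbl w
      lx≡lw = proj₂ (agrees₁₂ x⊑T₁)

      -- z lies between x and (p, e) and looks like x; maximality of the frontier vertex x forces z = x.
      w⊆x : leaves w ⊆ leaves x
      w⊆x with ⊑⇒≡⊎⊏ x⊑z
      ... | inj₁ x≡z = subst (λ t → leaves w ⊆ leaves t) (sym x≡z) w⊆z
      ... | inj₂ x⊏z = ⊥-elim (¬red-x (Redundant-lookalike wf-u between-x x⊏z z⊑u x⊏u
                                 (trans μx≡μw (proj₁ (agrees₂₁ w⊑T₂))) (trans lx≡lw (proj₂ (agrees₂₁ w⊑T₂)))))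

      w⊑ds : w ⊑L ds
      w⊑ds with ⊑⇒≡⊎⊏ w⊑u′
      ... | inj₁ w≡u′       = ⊥-elim (⊏⇒leaves⊈ wf-u u! x⊏u (w⊆x ∘ subst (λ t → _ ∈ leaves t) (sym w≡u′) ∘ cs⊆ds))
      ... | inj₂ (⊏-node w⊑ds) = w⊑ds

      y⊑T₂ : ∀ {y} → y ⊑L ds → y ⊑ T₂
      y⊑T₂ (_ , d∈ , y⊑d) = ⊑-trans (⊑-child d∈ y⊑d) u′⊑

      y⊆mmap-y : ∀ {y} → y ⊑L ds → leaves y ⊆ leaves (mmap T₁ y)
      y⊆mmap-y y⊑ds = lca-covers T₁ (leaves-⊑ u⊑ ∘ ds⊆cs ∘ leaves-⊑L y⊑ds)

      x⊑mmap-y : ∀ {y} → w ⊏ y → y ⊑L ds → x ⊑ mmap T₁ y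
      x⊑mmap-y {y} w⊏y y⊑ds = leaves-⊆⇒⊑ wf₁ T₁! x⊑T₁ (lca-⊑ T₁ (leaves y)) (y⊆mmap-y y⊑ds ∘ leaves-⊏ w⊏y ∘ x⊆w)

      mmap-y⊑u : ∀ {y} → w ⊏ y → y ⊑L ds → mmap T₁ y ⊑ node p e cs
      mmap-y⊑u w⊏y y⊑ds = lca-least T₁! u⊑ (ds⊆cs ∘ leaves-⊑L y⊑ds) (leaves-⊏ w⊏y (x⊆w (proj₂ x-leaf)))

      between-w : RedundantBetween p e w (_⊑L ds)
      between-w {y} w⊏y y⊑ds with ⊑⇒≡⊎⊏ (x⊑mmap-y w⊏y y⊑ds)
      ... | inj₁ x≡z′ = ⊥-elim (⊏⇒⋣ w⊏y (leaves-⊆⇒⊑ wf₂ T₂! (y⊑T₂ y⊑ds) w⊑T₂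
                          (x⊆w ∘ subst (λ t → _ ∈ leaves t) (sym x≡z′) ∘ y⊆mmap-y y⊑ds)))
      ... | inj₂ x⊏z′ = Redundant-lookalike wf-u′ between-x x⊏z′ (mmap-y⊑u w⊏y y⊑ds) (⊏-node y⊑ds)
                          (proj₁ (agrees₂₁ (y⊑T₂ y⊑ds))) (proj₂ (agrees₂₁ (y⊑T₂ y⊑ds)))

    mmap-frontier-∈ : mmap T₂ x ∈ frontierL p e ds
    mmap-frontier-∈ = frontierL-complete w⊑ds (¬red-x ∘ λ red-w → Redundant-resp red-w μx≡μw lx≡lw) between-w

    mmap-frontier-⊆ : leaves (mmap T₂ x) ⊆ leaves x
    mmap-frontier-⊆ = w⊆x

    mmap-frontier-⊇ : leaves x ⊆ leaves (mmap T₂ x)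
    mmap-frontier-⊇ = x⊆w

    mmap-frontier-inverse : mmap T₁ (mmap T₂ x) ≡ x
    mmap-frontier-inverse = trans (lca-cong T₁ w⊆x x⊆w) (mmap-self wf₁ T₁! x⊑T₁)

module Isomorphic (𝒢₁ 𝒢₂ : RGT) (agrees₁₂ : Agrees (G 𝒢₁) (G 𝒢₂)) (agrees₂₁ : Agrees (G 𝒢₂) (G 𝒢₁)) where

  open RGT 𝒢₁ using () renaming (G to T₁; wf to wf₁; leaves-distinct to T₁!)
  open RGT 𝒢₂ using () renaming (G to T₂; wf to wf₂; leaves-distinct to T₂!)
  module M₁₂ = Matching 𝒢₁ 𝒢₂ agrees₁₂ agrees₂₁
  module M₂₁ = Matching 𝒢₂ 𝒢₁ agrees₂₁ agrees₁₂

  frontierL-↭ : ∀ {p e cs ds} → node p e cs ⊑ T₁ → node p e ds ⊑ T₂ →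
                leavesL cs ⊆ leavesL ds → leavesL ds ⊆ leavesL cs →
                frontierL p e cs ↭ map (mmap T₁) (frontierL p e ds)
  frontierL-↭ {p} {e} {cs} {ds} u⊑ u′⊑ cs⊆ds ds⊆cs =
    unique∧set⇒↭ (frontierL-Unique (WF-⊑ u⊑ wf₁) (Unique-leaves-⊑ u⊑ T₁!))
                 (Unique-map⁺-leftInverse {g = mmap T₂} (All.tabulate (M₂₁.mmap-frontier-inverse u′⊑ u⊑ ds⊆cs cs⊆ds))
                                          (frontierL-Unique (WF-⊑ u′⊑ wf₂) (Unique-leaves-⊑ u′⊑ T₂!)))
                 cs⊆ds-image ds-image⊆cs
    where
    cs⊆ds-image : frontierL p e cs ⊆ map (mmap T₁) (frontierL p e ds)
    cs⊆ds-image x∈ = subst (_∈ map (mmap T₁) (frontierL p e ds)) (M₁₂.mmap-frontier-inverse u⊑ u′⊑ cs⊆ds ds⊆cs x∈)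
                           (∈-map⁺ (mmap T₁) (M₁₂.mmap-frontier-∈ u⊑ u′⊑ cs⊆ds ds⊆cs x∈))

    ds-image⊆cs : map (mmap T₁) (frontierL p e ds) ⊆ frontierL p e cs
    ds-image⊆cs m∈ with ∈-map⁻ (mmap T₁) m∈
    ... | y , y∈ , refl = M₂₁.mmap-frontier-∈ u′⊑ u⊑ ds⊆cs cs⊆ds y∈

  LR-≅ : ∀ {u u′} → Acc _⊏_ u → u ⊑ T₁ → u′ ⊑ T₂ → leaves u ⊆ leaves u′ → leaves u′ ⊆ leaves u → LR u ≅T LR u′
  LR-≅ {leaf _ _} {leaf _ _} _ u⊑ u′⊑ u⊆u′ u′⊆u with M₁₂.same-leaves⇒agree u⊑ u′⊑ u⊆u′ u′⊆u | u⊆u′ (here refl)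
  ... | refl , _ | here refl = leaf≅
  LR-≅ {leaf _ _} {node _ _ _} _ u⊑ u′⊑ u⊆u′ u′⊆u with WF-⊑ u′⊑ wf₂
  ... | wf-node _ e≢extant _ _ _ _ = contradiction (sym (proj₂ (M₁₂.same-leaves⇒agree u⊑ u′⊑ u⊆u′ u′⊆u))) e≢extant
  LR-≅ {node _ _ _} {leaf _ _} _ u⊑ u′⊑ u⊆u′ u′⊆u with WF-⊑ u⊑ wf₁
  ... | wf-node _ e≢extant _ _ _ _ = contradiction (proj₂ (M₁₂.same-leaves⇒agree u⊑ u′⊑ u⊆u′ u′⊆u)) e≢extant
  LR-≅ {node p e cs} {node _ _ ds} (acc rs) u⊑ u′⊑ cs⊆ds ds⊆cs with M₁₂.same-leaves⇒agree u⊑ u′⊑ cs⊆ds ds⊆cs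
  ... | refl , refl rewrite LRL-frontierL p e cs | LRL-frontierL p e ds =
    node≅ _ (↭.map⁺ LR (frontierL-↭ u⊑ u′⊑ cs⊆ds ds⊆cs)) (children-≅ (frontierL p e ds) (λ y∈ → y∈))
    where
    frontier₁-⊏ : ∀ {x} → x ∈ frontierL p e cs → x ⊏ node p e cs
    frontier₁-⊏ = frontierL-⊏ (WF-⊑ u⊑ wf₁) (Unique-leaves-⊑ u⊑ T₁!)

    frontier₂-⊏ : ∀ {y} → y ∈ frontierL p e ds → y ⊏ node p e ds
    frontier₂-⊏ = frontierL-⊏ (WF-⊑ u′⊑ wf₂) (Unique-leaves-⊑ u′⊑ T₂!)

    child-≅ : ∀ {y} → y ∈ frontierL p e ds → LR (mmap T₁ y) ≅T LR y
    child-≅ {y} y∈ = LR-≅ (rs m⊏u) (⊑-trans (⊏⇒⊑ m⊏u) u⊑) (⊑-trans (⊏⇒⊑ (frontier₂-⊏ y∈)) u′⊑)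
                      (M₂₁.mmap-frontier-⊆ u′⊑ u⊑ ds⊆cs cs⊆ds y∈) (M₂₁.mmap-frontier-⊇ u′⊑ u⊑ ds⊆cs cs⊆ds y∈)
      where
      m⊏u : mmap T₁ y ⊏ node p e cs
      m⊏u = frontier₁-⊏ (M₂₁.mmap-frontier-∈ u′⊑ u⊑ ds⊆cs cs⊆ds y∈)

    children-≅ : ∀ ys → ys ⊆ frontierL p e ds → Pointwise _≅T_ (map LR (map (mmap T₁) ys)) (map LR ys)
    children-≅ []       _     = []
    children-≅ (y ∷ ys) ys⊆ds = child-≅ (ys⊆ds (here refl)) ∷ children-≅ ys (ys⊆ds ∘ there)

-- The distance

mutual
  sumV≡0⇒ : ∀ f G → sumV f G ≡ 0 → ∀ {v} → v ⊑ G → f v ≡ 0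
  sumV≡0⇒ f (leaf _ _)    sum≡0 ⊑-refl            = sum≡0
  sumV≡0⇒ f (node _ _ _)  sum≡0 ⊑-refl            = m+n≡0⇒m≡0 _ sum≡0
  sumV≡0⇒ f (node p e cs) sum≡0 (⊑-child c∈ v⊑c) =
    sumVL≡0⇒ f cs (m+n≡0⇒n≡0 (f (node p e cs)) sum≡0) (_ , c∈ , v⊑c)

  sumVL≡0⇒ : ∀ f cs → sumVL f cs ≡ 0 → ∀ {v} → v ⊑L cs → f v ≡ 0
  sumVL≡0⇒ f (c ∷ cs) sum≡0 (_ , here refl , v⊑c) = sumV≡0⇒ f c (m+n≡0⇒m≡0 _ sum≡0) v⊑c
  sumVL≡0⇒ f (c ∷ cs) sum≡0 (d , there d∈ , v⊑d) = sumVL≡0⇒ f cs (m+n≡0⇒n≡0 (sumV f c) sum≡0) (d , d∈ , v⊑d)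

mutual
  sumV≡0⇐ : ∀ f G → (∀ {v} → v ⊑ G → f v ≡ 0) → sumV f G ≡ 0
  sumV≡0⇐ f (leaf _ _)    all≡0 = all≡0 ⊑-refl
  sumV≡0⇐ f (node _ _ cs) all≡0 =
    cong₂ _+_ (all≡0 ⊑-refl) (sumVL≡0⇐ f cs λ (_ , c∈ , v⊑c) → all≡0 (⊑-child c∈ v⊑c))

  sumVL≡0⇐ : ∀ f cs → (∀ {v} → v ⊑L cs → f v ≡ 0) → sumVL f cs ≡ 0
  sumVL≡0⇐ f []       _     = refl
  sumVL≡0⇐ f (c ∷ cs) all≡0 =
    cong₂ _+_ (sumV≡0⇐ f c λ v⊑c → all≡0 (c , here refl , v⊑c))
              (sumVL≡0⇐ f cs λ (d , d∈ , v⊑d) → all≡0 (d , there d∈ , v⊑d))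

distS-∷ : ∀ d p q → distS (d ∷ p) (d ∷ q) ≡ distS p q
distS-∷ d p q = lemma d
  where
  2+2k : ∀ m n k → (suc m + suc n) ∸ (2 * suc k) ≡ (m + n) ∸ (2 * k)
  2+2k m n k rewrite +-suc m n | +-suc k (k + 0) = refl
  lemma : ∀ d → distS (d ∷ p) (d ∷ q) ≡ distS p q
  lemma left  = 2+2k (length p) (length q) (cpl p q)
  lemma right = 2+2k (length p) (length q) (cpl p q)

distS-refl : ∀ p → distS p p ≡ 0
distS-refl []      = refl
distS-refl (d ∷ p) = trans (distS-∷ d p p) (distS-refl p)

distS≡0⇒≡ : ∀ p q → distS p q ≡ 0 → p ≡ q
distS≡0⇒≡ []          []          _ = refl
distS≡0⇒≡ (left ∷ p)  (left ∷ q)  d≡0 = cong (left ∷_) (distS≡0⇒≡ p q (trans (sym (distS-∷ left p q)) d≡0))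
distS≡0⇒≡ (right ∷ p) (right ∷ q) d≡0 = cong (right ∷_) (distS≡0⇒≡ p q (trans (sym (distS-∷ right p q)) d≡0))
distS≡0⇒≡ []          (_ ∷ _)     ()
distS≡0⇒≡ (left ∷ _)  []          ()
distS≡0⇒≡ (right ∷ _) []          ()
distS≡0⇒≡ (left ∷ _)  (right ∷ _) ()
distS≡0⇒≡ (right ∷ _) (left ∷ _)  ()

mismatch≡0⇒≡ : ∀ a b → (if does (a ≟E b) then 0 else 1) ≡ 0 → a ≡ b
mismatch≡0⇒≡ a b _ with a ≟E b
mismatch≡0⇒≡ a b _  | yes a≡b = a≡b
mismatch≡0⇒≡ a b () | no _

mismatch-refl : ∀ a → (if does (a ≟E a) then 0 else 1) ≡ 0
mismatch-refl a rewrite dec-true (a ≟E a) refl = refl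

zero-distance⇒Agrees : ∀ G₁ G₂ → dpath G₁ G₂ ≡ 0 → dlbl G₁ G₂ ≡ 0 → Agrees G₁ G₂
zero-distance⇒Agrees G₁ G₂ dpath≡0 dlbl≡0 v⊑ =
  distS≡0⇒≡ _ _ (sumV≡0⇒ _ G₁ dpath≡0 v⊑) , mismatch≡0⇒≡ _ _ (sumV≡0⇒ _ G₁ dlbl≡0 v⊑)

dpath-self : ∀ {S G} → WF S G → Unique (leaves G) → dpath G G ≡ 0
dpath-self {G = G} wf G! = sumV≡0⇐ _ G λ {v} v⊑ →
  trans (cong (distS (μ v) ∘ μ) (mmap-self wf G! v⊑)) (distS-refl (μ v))

dlbl-self : ∀ {S G} → WF S G → Unique (leaves G) → dlbl G G ≡ 0
dlbl-self {G = G} wf G! = sumV≡0⇐ _ G λ {v} v⊑ →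
  trans (cong (λ m → if does (lbl v ≟E lbl m) then 0 else 1) (mmap-self wf G! v⊑)) (mismatch-refl (lbl v))

mutual
  genes-leafMap : ∀ G → map proj₁ (leafMap G) ≡ leaves G
  genes-leafMap (leaf _ _)    = refl
  genes-leafMap (node _ _ cs) = genes-leafMapL cs

  genes-leafMapL : ∀ cs → map proj₁ (leafMapL cs) ≡ leavesL cs
  genes-leafMapL []       = refl
  genes-leafMapL (c ∷ cs) =
    trans (map-++ proj₁ (leafMap c) (leafMapL cs)) (cong₂ _++_ (genes-leafMap c) (genes-leafMapL cs))

Unique-keys⇒functional : ∀ {A B : Set} (kvs : List (A × B)) {kv kv′} → Unique (map proj₁ kvs) →
                         kv ∈ kvs → kv′ ∈ kvs → proj₁ kv ≡ proj₁ kv′ → proj₂ kv ≡ proj₂ kv′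
Unique-keys⇒functional (_ ∷ _)   _          (here refl) (here refl) _     = refl
Unique-keys⇒functional (_ ∷ _)   (k∉ ∷ _)    (here refl) (there kv′∈) k≡k′ =
  contradiction k≡k′ (All.lookup k∉ (∈-map⁺ proj₁ kv′∈))
Unique-keys⇒functional (_ ∷ _)   (k∉ ∷ _)    (there kv∈) (here refl)  k≡k′ =
  contradiction (sym k≡k′) (All.lookup k∉ (∈-map⁺ proj₁ kv∈))
Unique-keys⇒functional (_ ∷ kvs) (_ ∷ keys!) (there kv∈) (there kv′∈) k≡k′ =
  Unique-keys⇒functional kvs keys! kv∈ kv′∈ k≡k′

Comparable-refl : ∀ 𝒢 → Comparable 𝒢 𝒢
Comparable-refl 𝒢 = refl , All.tabulate (λ x∈ → x∈) , All.tabulate (λ x∈ → x∈) ,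
  All.tabulate (λ xp∈ → All.tabulate (Unique-keys⇒functional (leafMap (G 𝒢)) keys! xp∈))
  where
  keys! : Unique (map proj₁ (leafMap (G 𝒢)))
  keys! = subst Unique (sym (genes-leafMap (G 𝒢))) (leaves-distinct 𝒢)

Comparable-sym : ∀ 𝒢₁ 𝒢₂ → Comparable 𝒢₁ 𝒢₂ → Comparable 𝒢₂ 𝒢₁
Comparable-sym _ _ (S≡ , G₁⊆G₂ , G₂⊆G₁ , consistent) = sym S≡ , G₂⊆G₁ , G₁⊆G₂ ,
  All.tabulate (λ yq∈ → All.tabulate (λ xp∈ y≡x → sym (All.lookup (All.lookup consistent xp∈) yq∈ (sym y≡x))))

zero-distance⇒≃d : ∀ 𝒢₁ 𝒢₂ → Comparable 𝒢₁ 𝒢₂ →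
                   dpath (G 𝒢₁) (G 𝒢₂) ≡ 0 → dlbl (G 𝒢₁) (G 𝒢₂) ≡ 0 →
                   dpath (G 𝒢₂) (G 𝒢₁) ≡ 0 → dlbl (G 𝒢₂) (G 𝒢₁) ≡ 0 → 𝒢₁ ≃d 𝒢₂
zero-distance⇒≃d 𝒢₁ 𝒢₂ (S≡ , G₁⊆G₂ , G₂⊆G₁ , _) dpath₁₂ dlbl₁₂ dpath₂₁ dlbl₂₁ =
  S≡ , Isomorphic.LR-≅ 𝒢₁ 𝒢₂ (zero-distance⇒Agrees (G 𝒢₁) (G 𝒢₂) dpath₁₂ dlbl₁₂)
                             (zero-distance⇒Agrees (G 𝒢₂) (G 𝒢₁) dpath₂₁ dlbl₂₁)
         (⊏-wellFounded (G 𝒢₁)) ⊑-refl ⊑-refl (All.lookup G₁⊆G₂) (All.lookup G₂⊆G₁)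

*-toℚ-nonNeg : ∀ {β} → 0ℚ < β → ∀ n → NonNegative (β *ℚ toℚ n)
*-toℚ-nonNeg {β} 0<β n = nonNeg*nonNeg⇒nonNeg β {{pos⇒nonNeg β {{positive 0<β}}}} (toℚ n) {{normalize-nonNeg n 1}}

*-toℚ-pos : ∀ {β} → 0ℚ < β → ∀ n → Positive (β *ℚ toℚ (suc n))
*-toℚ-pos {β} 0<β n = pos*pos⇒pos β {{positive 0<β}} (toℚ (suc n)) {{normalize-pos (suc n) 1}}

module _ {α : ℚ} (0<α : 0ℚ < α) (α<1 : α < 1ℚ) where

  private
    0<1-α : 0ℚ < 1ℚ -ℚ α
    0<1-α = subst (_< 1ℚ -ℚ α) (+-inverseʳ α) (+-monoˡ-< (- α) α<1)

  weighted-nonNeg : ∀ m n → NonNegative (α *ℚ toℚ m +ℚ (1ℚ -ℚ α) *ℚ toℚ n)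
  weighted-nonNeg m n =
    nonNeg+nonNeg⇒nonNeg (α *ℚ toℚ m) {{*-toℚ-nonNeg 0<α m}} ((1ℚ -ℚ α) *ℚ toℚ n) {{*-toℚ-nonNeg 0<1-α n}}

  weighted-zero⊎pos : ∀ m n → (m ≡ 0 × n ≡ 0) ⊎ Positive (α *ℚ toℚ m +ℚ (1ℚ -ℚ α) *ℚ toℚ n)
  weighted-zero⊎pos zero    zero    = inj₁ (refl , refl)
  weighted-zero⊎pos (suc m) n       = inj₂ (pos+nonNeg⇒pos (α *ℚ toℚ (suc m)) {{*-toℚ-pos 0<α m}}
                                                            ((1ℚ -ℚ α) *ℚ toℚ n) {{*-toℚ-nonNeg 0<1-α n}})
  weighted-zero⊎pos zero    (suc n) = inj₂ (nonNeg+pos⇒pos (α *ℚ toℚ 0) {{*-toℚ-nonNeg 0<α 0}}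
                                                            ((1ℚ -ℚ α) *ℚ toℚ (suc n)) {{*-toℚ-pos 0<1-α n}})

  dasym-sum-pos : ∀ G₁ G₂ → ¬ (dpath G₁ G₂ ≡ 0 × dlbl G₁ G₂ ≡ 0 × dpath G₂ G₁ ≡ 0 × dlbl G₂ G₁ ≡ 0) →
                  0ℚ < dasym α G₁ G₂ +ℚ dasym α G₂ G₁
  dasym-sum-pos G₁ G₂ ¬zero
    with weighted-zero⊎pos (dpath G₁ G₂) (dlbl G₁ G₂) | weighted-zero⊎pos (dpath G₂ G₁) (dlbl G₂ G₁)
  ... | inj₁ (dpath₁₂ , dlbl₁₂) | inj₁ (dpath₂₁ , dlbl₂₁) = contradiction (dpath₁₂ , dlbl₁₂ , dpath₂₁ , dlbl₂₁) ¬zero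
  ... | inj₂ pos₁₂ | _ = positive⁻¹ (dasym α G₁ G₂ +ℚ dasym α G₂ G₁)
                           {{pos+nonNeg⇒pos (dasym α G₁ G₂) {{pos₁₂}}
                                            (dasym α G₂ G₁) {{weighted-nonNeg (dpath G₂ G₁) (dlbl G₂ G₁)}}}}
  ... | inj₁ _ | inj₂ pos₂₁ = positive⁻¹ (dasym α G₁ G₂ +ℚ dasym α G₂ G₁)
                           {{nonNeg+pos⇒pos (dasym α G₁ G₂) {{weighted-nonNeg (dpath G₁ G₂) (dlbl G₁ G₂)}}
                                            (dasym α G₂ G₁) {{pos₂₁}}}}

dasym-self : ∀ α {S G} → WF S G → Unique (leaves G) → dasym α G G ≡ 0ℚ
dasym-self α wf G! rewrite dpath-self wf G! | dlbl-self wf G! =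
  trans (cong₂ _+ℚ_ (*-zeroʳ α) (*-zeroʳ (1ℚ -ℚ α))) (+-identityʳ 0ℚ)

dPLR-comparable : ∀ α 𝒢₁ 𝒢₂ → Comparable 𝒢₁ 𝒢₂ →
                  dPLR α 𝒢₁ 𝒢₂ ≡ fin (dasym α (G 𝒢₁) (G 𝒢₂) +ℚ dasym α (G 𝒢₂) (G 𝒢₁))
dPLR-comparable α 𝒢₁ 𝒢₂ comparable with comparable? 𝒢₁ 𝒢₂
... | yes _ = refl
... | no ¬comparable = contradiction comparable ¬comparable

dPLR-incomparable : ∀ α 𝒢₁ 𝒢₂ → ¬ Comparable 𝒢₁ 𝒢₂ → dPLR α 𝒢₁ 𝒢₂ ≡ ∞
dPLR-incomparable α 𝒢₁ 𝒢₂ ¬comparable with comparable? 𝒢₁ 𝒢₂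
... | yes comparable = contradiction comparable ¬comparable
... | no _ = refl

dPLR-refl : ∀ α 𝒢 → dPLR α 𝒢 𝒢 ≡ fin 0ℚ
dPLR-refl α 𝒢 = trans (dPLR-comparable α 𝒢 𝒢 (Comparable-refl 𝒢))
  (cong fin (trans (cong₂ _+ℚ_ dasym≡0 dasym≡0) (+-identityʳ 0ℚ)))
  where
  dasym≡0 : dasym α (G 𝒢) (G 𝒢) ≡ 0ℚ
  dasym≡0 = dasym-self α (wf 𝒢) (leaves-distinct 𝒢)

dPLR-sym : ∀ α 𝒢₁ 𝒢₂ → dPLR α 𝒢₁ 𝒢₂ ≡ dPLR α 𝒢₂ 𝒢₁
dPLR-sym α 𝒢₁ 𝒢₂ = by-comparability (comparable? 𝒢₁ 𝒢₂)
  where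
  by-comparability : Dec (Comparable 𝒢₁ 𝒢₂) → dPLR α 𝒢₁ 𝒢₂ ≡ dPLR α 𝒢₂ 𝒢₁
  by-comparability (yes c) = begin
    dPLR α 𝒢₁ 𝒢₂                                          ≡⟨ dPLR-comparable α 𝒢₁ 𝒢₂ c ⟩
    fin (dasym α (G 𝒢₁) (G 𝒢₂) +ℚ dasym α (G 𝒢₂) (G 𝒢₁)) ≡⟨ cong fin (+-comm (dasym α (G 𝒢₁) (G 𝒢₂)) _) ⟩
    fin (dasym α (G 𝒢₂) (G 𝒢₁) +ℚ dasym α (G 𝒢₁) (G 𝒢₂)) ≡⟨ dPLR-comparable α 𝒢₂ 𝒢₁ (Comparable-sym 𝒢₁ 𝒢₂ c) ⟨
    dPLR α 𝒢₂ 𝒢₁                                          ∎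
    where open ≡-Reasoning
  by-comparability (no ¬c) =
    trans (dPLR-incomparable α 𝒢₁ 𝒢₂ ¬c) (sym (dPLR-incomparable α 𝒢₂ 𝒢₁ (¬c ∘ Comparable-sym 𝒢₂ 𝒢₁)))

dPLR-positive : ∀ {α} → 0ℚ < α → α < 1ℚ → ∀ 𝒢₁ 𝒢₂ → ¬ (𝒢₁ ≃d 𝒢₂) → Positive∞ (dPLR α 𝒢₁ 𝒢₂)
dPLR-positive 0<α α<1 𝒢₁ 𝒢₂ ≄d with comparable? 𝒢₁ 𝒢₂
... | no _ = tt
... | yes c = dasym-sum-pos 0<α α<1 (G 𝒢₁) (G 𝒢₂)
                λ (dpath₁₂ , dlbl₁₂ , dpath₂₁ , dlbl₂₁) →
                  ≄d (zero-distance⇒≃d 𝒢₁ 𝒢₂ c dpath₁₂ dlbl₁₂ dpath₂₁ dlbl₂₁)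

theorem2 : (α : ℚ) → 0ℚ < α → α < 1ℚ →
    ((𝒢 : RGT) → dPLR α 𝒢 𝒢 ≡ fin 0ℚ)
    × ((𝒢₁ 𝒢₂ : RGT) → dPLR α 𝒢₁ 𝒢₂ ≡ dPLR α 𝒢₂ 𝒢₁)
    × ((𝒢₁ 𝒢₂ : RGT) → ¬ (𝒢₁ ≃d 𝒢₂) → Positive∞ (dPLR α 𝒢₁ 𝒢₂))
theorem2 α 0<α α<1 = dPLR-refl α , dPLR-sym α , dPLR-positive 0<α α<1
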